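{- Let $(\varphi_k)_{k\ge0}$ be non-negative with $\varphi_0>0$ and let $n\ge1$. Let $I_n$ be the number of inner nodes of a random ordered increasing diamond of size $n$, chosen with probability proportional to its weight, and let $N_n$ be the number of nodes of capacity one in a random ordered bucket increasing tree of size $n$ with maximal bucket size $2$, weights $(\varphi_k)$ and $\psi_1=1$, chosen with probability proportional to its weight. Then there is a weight-preserving bijection between the two families of size $n$ under which the number of inner nodes of a diamond equals the number of capacity-one nodes of the corresponding tree; consequently $I_n$ and $N_n$ are equal in distribution.
   Context: Ordered increasing diamonds are defined recursively on finite label sets $L\subset\mathbb{N}$: if $|L|=1$ the diamond is a single node carrying that label, with weight $1$; if $|L|\ge2$ it consists of a source node labelled $\min L$, a sink node labelled $\max L$, and an ordered sequence $(F_1,\dots,F_r)$, $r\ge0$, of increasing diamonds whose label sets partition $L\setminus\{\min L,\max L\}$, with the source joined to the source of each $F_i$ and the sink of each $F_i$ joined to the sink; its weight is $\varphi_r\prod_i w(F_i)$. Size = number of nodes. Node types are assigned recursively: in a size-one diamond its node is an inner node; otherwise the source is a small node, the sink is a large node, and the assignment is applied recursively to $F_1,\dots,F_r$. Ordered bucket increasing trees with maximal bucket size $2$: rooted plane trees whose nodes are buckets of capacity $1$ or $2$, internal nodes of capacity $2$, labels $1,\dots,n$ distributed so each node holds $c(v)$ labels and labels increase along root-to-leaf paths; size $\sum_v c(v)$; weight $\prod_v w(v)$ with $w(v)=\varphi_{\deg^+(v)}$ if $c(v)=2$ and $w(v)=1$ if $c(v)=1$. -}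

module Defs where

open import Data.Nat using (ℕ; zero; suc; _+_; _≡ᵇ_; _<ᵇ_)
open import Data.Bool using (Bool; true; false; _∧_; T)
open import Data.List using (List; []; _∷_; _++_; length; map; upTo)
open import Data.Bool.ListAction using (all; any)
open import Data.Product using (Σ; proj₁)
open import Algebra.Bundles using (CommutativeSemiring)

-- An object "of size n" carries the labels 1,…,n, each
-- exactly once.  `isLabelling ls n` checks that the list of labels ls
-- has length n and contains every label 1,…,n (hence is a permutation
-- of 1,…,n).  Everything is Bool-valued, so the predicates `T …` are
-- proof-irrelevant and Σ-types below have exactly one element per object.

labelRange : ℕ → List ℕ
labelRange n = map suc (upTo n)

isLabelling : List ℕ → ℕ → Bool
isLabelling ls n = (length ls ≡ᵇ n) ∧ all (λ i → any (λ j → i ≡ᵇ j) ls) (labelRange n)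

-- Ordered increasing diamonds (raw shape).
--   leaf a        : size-one diamond with label a (an inner node)
--   node s Fs t   : source labelled s, ordered sequence Fs = (F₁,…,F_r)
--                   of sub-diamonds, sink labelled t.

data Dia : Set where
  leaf : ℕ → Dia
  node : ℕ → List Dia → ℕ → Dia

mutual
  diaLabels : Dia → List ℕ
  diaLabels (leaf a) = a ∷ []
  diaLabels (node s Fs t) = s ∷ t ∷ diaLabelsL Fs

  diaLabelsL : List Dia → List ℕ
  diaLabelsL [] = []
  diaLabelsL (F ∷ Fs) = diaLabels F ++ diaLabelsL Fs

-- Together with the global labelling condition
-- (distinct labels) the label sets of the Fᵢ partition L ∖ {min L, max L}.
mutual
  diaOK : Dia → Bool
  diaOK (leaf a) = true
  diaOK (node s Fs t) =
    (s <ᵇ t) ∧ all (λ x → s <ᵇ x) (diaLabelsL Fs)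
             ∧ all (λ x → x <ᵇ t) (diaLabelsL Fs) ∧ diaOKL Fs

  diaOKL : List Dia → Bool
  diaOKL [] = true
  diaOKL (F ∷ Fs) = diaOK F ∧ diaOKL Fs

Diamond : ℕ → Set
Diamond n = Σ Dia (λ d → T (diaOK d ∧ isLabelling (diaLabels d) n))

mutual
  innerNodes : Dia → ℕ
  innerNodes (leaf a) = 1
  innerNodes (node s Fs t) = innerNodesL Fs

  innerNodesL : List Dia → ℕ
  innerNodesL [] = 0
  innerNodesL (F ∷ Fs) = innerNodes F + innerNodesL Fs

-- Ordered bucket increasing trees with maximal bucket size 2 (raw shape).
--   one a          : bucket of capacity 1 with label a (necessarily a leaf)
--   two a b Ts     : bucket of capacity 2 with labels a < b and ordered
--                    list of subtrees Ts (possibly empty).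

data BT : Set where
  one : ℕ → BT
  two : ℕ → ℕ → List BT → BT

mutual
  btLabels : BT → List ℕ
  btLabels (one a) = a ∷ []
  btLabels (two a b Ts) = a ∷ b ∷ btLabelsL Ts

  btLabelsL : List BT → List ℕ
  btLabelsL [] = []
  btLabelsL (T′ ∷ Ts) = btLabels T′ ++ btLabelsL Ts

mutual
  btOK : BT → Bool
  btOK (one a) = true
  btOK (two a b Ts) = (a <ᵇ b) ∧ all (λ x → b <ᵇ x) (btLabelsL Ts) ∧ btOKL Ts

  btOKL : List BT → Bool
  btOKL [] = true
  btOKL (T′ ∷ Ts) = btOK T′ ∧ btOKL Ts

BucketTree : ℕ → Set
BucketTree n = Σ BT (λ t → T (btOK t ∧ isLabelling (btLabels t) n))

mutual
  capOne : BT → ℕ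
  capOne (one a) = 1
  capOne (two a b Ts) = capOneL Ts

  capOneL : List BT → ℕ
  capOneL [] = 0
  capOneL (T′ ∷ Ts) = capOne T′ + capOneL Ts

module Weights {c ℓ} (R : CommutativeSemiring c ℓ)
                     (φ : ℕ → CommutativeSemiring.Carrier R) where
  open CommutativeSemiring R

  mutual
    diaWeight : Dia → Carrier
    diaWeight (leaf a) = 1#
    diaWeight (node s Fs t) = φ (length Fs) * diaWeightL Fs

    diaWeightL : List Dia → Carrier
    diaWeightL [] = 1#
    diaWeightL (F ∷ Fs) = diaWeight F * diaWeightL Fs

  mutual
    -- w(v) = 1 (= ψ₁) for capacity 1, φ_{outdeg v} for capacity 2
    btWeight : BT → Carrier
    btWeight (one a) = 1#
    btWeight (two a b Ts) = φ (length Ts) * btWeightL Ts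

    btWeightL : List BT → Carrier
    btWeightL [] = 1#
    btWeightL (T′ ∷ Ts) = btWeight T′ * btWeightL Ts

-- A diamond node with source s, sink t and inner label set X becomes the bucket
-- (s, σ s) whose subtrees are the images of the sub-diamonds relabelled by σ, the
-- successor map of the finite set t ∷ X.  As s < X < t, σ maps s ∷ X monotonically
-- onto t ∷ X, so the bucket labels lie below all subtree labels.  Conversely a bucket
-- (a, b) is undone by relabelling its subtrees with the predecessor map of b ∷ Y and
-- taking max (b ∷ Y) as the sink.  Both constructions commute with strictly monotone
-- relabellings, which makes them mutually inverse on increasing objects; neither
-- touches the shape, so inner nodes go to capacity-one nodes and weights are kept.

module Submission where

open import Defs
open import Algebra.Bundles using (CommutativeSemiring)
open import Data.Bool.Base using (Bool; T; _∧_)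
open import Data.Bool.ListAction using (all)
open import Data.Bool.Properties using (T-∧; T-irrelevant)
open import Data.Empty using (⊥; ⊥-elim)
open import Data.List.Base using (List; []; _∷_; _++_; length; map; filter)
open import Data.List.Extrema.Nat
  using (min; max; argmin-sel; argmax-sel; min≤⊤; min≤xs; v<min⁺; ⊥≤max; xs≤max; max<v⁺; max≤v⁺)
open import Data.List.Membership.Propositional using (_∈_)
open import Data.List.Membership.Propositional.Properties using (∈-map⁺; ∈-map⁻; ∈-filter⁺; ∈-filter⁻)
open import Data.List.Properties using (map-++; length-map; length-++)
open import Data.List.Relation.Binary.Subset.Propositional using (_⊆_)
open import Data.List.Relation.Binary.Subset.Propositional.Properties
  using (⊆-trans; ⊆-reflexive; map⁺; ∷⁺ʳ; ∈-∷⁺ʳ; ++⁺; xs⊆xs++ys; xs⊆ys++xs; Any-resp-⊆)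
open import Data.List.Relation.Unary.All as All using (All; []; _∷_)
import Data.List.Relation.Unary.All.Properties as All
open import Data.List.Relation.Unary.Any using (here; there)
open import Data.List.Relation.Unary.Any.Properties using (any⁺; any⁻)
open import Data.Nat using (ℕ; _≤_; _<_; suc; _+_; _<ᵇ_; _≡ᵇ_)
open import Data.Nat.Properties
open import Data.Product using (Σ; _×_; _,_; proj₁)
open import Data.Product.Function.NonDependent.Propositional using (_×-⇔_)
open import Data.Sum.Base using (inj₁; inj₂)
open import Function.Base using (_∘_; id)
open import Function.Bundles using (_⤖_; Bijection; _⇔_; mk⇔; Equivalence; mk↔ₛ′)
open import Function.Properties.Equivalence using () renaming (trans to ⇔-trans)
open import Function.Properties.Inverse using (↔⇒⤖)
open import Relation.Binary.Definitions using (tri<; tri≈; tri>)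
open import Relation.Binary.PropositionalEquality
  using (_≡_; refl; sym; trans; cong; cong₂; subst; module ≡-Reasoning)
open import Relation.Nullary.Decidable using (yes; no)

private
  variable
    a b s t x y : ℕ
    g : ℕ → ℕ
    L U V X Y : List ℕ

T-<ᵇ : T (x <ᵇ y) ⇔ x < y
T-<ᵇ = mk⇔ (<ᵇ⇒< _ _) <⇒<ᵇ

T-all : ∀ {A : Set} {P : A → Set} {p : A → Bool} →
        (∀ {x} → T (p x) ⇔ P x) → ∀ {xs} → T (all p xs) ⇔ All P xs
T-all {p = p} p⇔P {xs} =
  mk⇔ (All.map (Equivalence.to p⇔P) ∘ All.all⁺ p xs) (All.all⁻ p ∘ All.map (Equivalence.from p⇔P))

data IncreasingDia : Dia → Set where
  leaf : IncreasingDia (leaf a)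
  node : ∀ {Fs} → s < t → All (s <_) (diaLabelsL Fs) → All (_< t) (diaLabelsL Fs) →
         All IncreasingDia Fs → IncreasingDia (node s Fs t)

data IncreasingBT : BT → Set where
  one : IncreasingBT (one a)
  two : ∀ {Ts} → a < b → All (b <_) (btLabelsL Ts) → All IncreasingBT Ts →
        IncreasingBT (two a b Ts)

mutual
  increasingDia : ∀ d → T (diaOK d) ⇔ IncreasingDia d
  increasingDia (leaf a)      = mk⇔ (λ _ → leaf) _
  increasingDia (node s Fs t) =
    ⇔-trans (⇔-trans T-∧ (T-<ᵇ ×-⇔ ⇔-trans T-∧ (T-all T-<ᵇ ×-⇔
                                   ⇔-trans T-∧ (T-all T-<ᵇ ×-⇔ increasingDias Fs))))
            (mk⇔ (λ (p , q , r , u) → node p q r u) λ { (node p q r u) → p , q , r , u })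

  increasingDias : ∀ Fs → T (diaOKL Fs) ⇔ All IncreasingDia Fs
  increasingDias []       = mk⇔ (λ _ → []) _
  increasingDias (F ∷ Fs) =
    ⇔-trans (⇔-trans T-∧ (increasingDia F ×-⇔ increasingDias Fs))
            (mk⇔ (λ (p , ps) → p ∷ ps) λ { (p ∷ ps) → p , ps })

mutual
  increasingBT : ∀ X → T (btOK X) ⇔ IncreasingBT X
  increasingBT (one a)      = mk⇔ (λ _ → one) _
  increasingBT (two a b Ts) =
    ⇔-trans (⇔-trans T-∧ (T-<ᵇ ×-⇔ ⇔-trans T-∧ (T-all T-<ᵇ ×-⇔ increasingBTs Ts)))
            (mk⇔ (λ (p , q , u) → two p q u) λ { (two p q u) → p , q , u })

  increasingBTs : ∀ Ts → T (btOKL Ts) ⇔ All IncreasingBT Ts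
  increasingBTs []       = mk⇔ (λ _ → []) _
  increasingBTs (X ∷ Ts) =
    ⇔-trans (⇔-trans T-∧ (increasingBT X ×-⇔ increasingBTs Ts))
            (mk⇔ (λ (p , ps) → p ∷ ps) λ { (p ∷ ps) → p , ps })

isLabelling-⊆ : ∀ {xs ys n} → length xs ≡ length ys → xs ⊆ ys →
                T (isLabelling xs n) → T (isLabelling ys n)
isLabelling-⊆ {xs} {ys} {n} |xs|≡|ys| xs⊆ys valid =
  let size , covered = Equivalence.to T-∧ valid in
  Equivalence.from T-∧
    ( subst (λ m → T (m ≡ᵇ n)) |xs|≡|ys| size
    , All.all⁻ _ (All.map (any⁺ _ ∘ Any-resp-⊆ xs⊆ys ∘ any⁻ _ xs) (All.all⁺ _ (labelRange n) covered)))

≡-on-shapes : ∀ {A : Set} {p : A → Bool} {u v : Σ A (λ x → T (p x))} → proj₁ u ≡ proj₁ v → u ≡ v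
≡-on-shapes {u = x , _} {v = x , _} refl = cong (x ,_) (T-irrelevant _ _)

-- Covering pairs relative to a finite set

record _⋖⟨_⟩_ (x : ℕ) (U : List ℕ) (y : ℕ) : Set where
  constructor covers
  field
    lt  : x < y
    gap : ∀ {z} → z ∈ U → x < z → z < y → ⊥
open _⋖⟨_⟩_

⋖-anti-mono : V ⊆ U → x ⋖⟨ U ⟩ y → x ⋖⟨ V ⟩ y
⋖-anti-mono V⊆U (covers x<y gap) = covers x<y (gap ∘ V⊆U)

⋖-unique-above : ∀ {y′} → y ∈ U → y′ ∈ U → x ⋖⟨ U ⟩ y → x ⋖⟨ U ⟩ y′ → y ≡ y′
⋖-unique-above {y} {y′ = y′} y∈U y′∈U x⋖y x⋖y′ with <-cmp y y′
... | tri< y<y′ _ _ = ⊥-elim (gap x⋖y′ y∈U (lt x⋖y) y<y′)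
... | tri≈ _ y≡y′ _ = y≡y′
... | tri> _ _ y′<y = ⊥-elim (gap x⋖y y′∈U (lt x⋖y′) y′<y)

⋖-unique-below : ∀ {x′} → x ∈ U → x′ ∈ U → x ⋖⟨ U ⟩ y → x′ ⋖⟨ U ⟩ y → x ≡ x′
⋖-unique-below {x} {x′ = x′} x∈U x′∈U x⋖y x′⋖y with <-cmp x x′
... | tri< x<x′ _ _ = ⊥-elim (gap x⋖y x′∈U x<x′ (lt x′⋖y))
... | tri≈ _ x≡x′ _ = x≡x′
... | tri> _ _ x′<x = ⊥-elim (gap x′⋖y x∈U x′<x (lt x⋖y))

StrictlyMonotoneOn : List ℕ → (ℕ → ℕ) → Set
StrictlyMonotoneOn L g = ∀ {x y} → x ∈ L → y ∈ L → x < y → g x < g y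

strictlyMonotoneOn-⊆ : V ⊆ U → StrictlyMonotoneOn U g → StrictlyMonotoneOn V g
strictlyMonotoneOn-⊆ V⊆U mono x∈V y∈V = mono (V⊆U x∈V) (V⊆U y∈V)

monotoneOn : StrictlyMonotoneOn L g → x ∈ L → y ∈ L → x ≤ y → g x ≤ g y
monotoneOn mono x∈L y∈L x≤y with m≤n⇒m<n∨m≡n x≤y
... | inj₁ x<y  = <⇒≤ (mono x∈L y∈L x<y)
... | inj₂ refl = ≤-refl

reflects-< : StrictlyMonotoneOn L g → x ∈ L → y ∈ L → g x < g y → x < y
reflects-< {x = x} {y = y} mono x∈L y∈L gx<gy with x <? y
... | yes x<y = x<y
... | no  x≮y = ⊥-elim (<⇒≱ gx<gy (monotoneOn mono y∈L x∈L (≮⇒≥ x≮y)))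

⋖-map : StrictlyMonotoneOn L g → U ⊆ L → x ∈ L → y ∈ L → x ⋖⟨ U ⟩ y → g x ⋖⟨ map g U ⟩ g y
⋖-map {g = g} mono U⊆L x∈L y∈L (covers x<y gap) = covers (mono x∈L y∈L x<y) gap′
  where
    gap′ : ∀ {z} → z ∈ map g _ → g _ < z → z < g _ → ⊥
    gap′ z∈gU gx<z z<gy with ∈-map⁻ g z∈gU
    ... | w , w∈U , refl =
      gap w∈U (reflects-< mono x∈L (U⊆L w∈U) gx<z) (reflects-< mono (U⊆L w∈U) y∈L z<gy)

-- For x < t, nextAbove t X x is the least element of t ∷ X above x; t is the default
-- of the minimum, so the value is junk for x ≥ t.  Dually nextBelow b Y y for b < y.

opaque
  nextAbove : ℕ → List ℕ → ℕ → ℕ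
  nextAbove t X x = min t (filter (x <?_) X)

  nextBelow : ℕ → List ℕ → ℕ → ℕ
  nextBelow b Y y = max b (filter (_<? y) Y)

opaque
  unfolding nextAbove nextBelow

  nextAbove-∈ : nextAbove t X x ∈ t ∷ X
  nextAbove-∈ {t} {X} {x} with argmin-sel id t (filter (x <?_) X)
  ... | inj₁ ≡t = here ≡t
  ... | inj₂ ∈F = there (proj₁ (∈-filter⁻ (x <?_) ∈F))

  nextBelow-∈ : nextBelow b Y y ∈ b ∷ Y
  nextBelow-∈ {b} {Y} {y} with argmax-sel id b (filter (_<? y) Y)
  ... | inj₁ ≡b = here ≡b
  ... | inj₂ ∈F = there (proj₁ (∈-filter⁻ (_<? y) ∈F))

  nextAbove-⋖ : x < t → x ⋖⟨ t ∷ X ⟩ nextAbove t X x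
  nextAbove-⋖ {x} {t} {X} x<t = covers (v<min⁺ x<t (All.all-filter (x <?_) X)) gap′
    where
      gap′ : ∀ {z} → z ∈ t ∷ X → x < z → z < nextAbove t X x → ⊥
      gap′ (here refl) _   z<m = <⇒≱ z<m (min≤⊤ t (filter (x <?_) X))
      gap′ (there z∈X) x<z z<m =
        <⇒≱ z<m (All.lookup (min≤xs t (filter (x <?_) X)) (∈-filter⁺ (x <?_) z∈X x<z))

  nextBelow-⋖ : b < y → nextBelow b Y y ⋖⟨ b ∷ Y ⟩ y
  nextBelow-⋖ {b} {y} {Y} b<y = covers (max<v⁺ b<y (All.all-filter (_<? y) Y)) gap′
    where
      gap′ : ∀ {z} → z ∈ b ∷ Y → nextBelow b Y y < z → z < y → ⊥
      gap′ (here refl) m<z _   = <⇒≱ m<z (⊥≤max b (filter (_<? y) Y))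
      gap′ (there z∈Y) m<z z<y =
        <⇒≱ m<z (All.lookup (xs≤max b (filter (_<? y) Y)) (∈-filter⁺ (_<? y) z∈Y z<y))

nextAbove-unique : x < t → y ∈ t ∷ X → x ⋖⟨ t ∷ X ⟩ y → nextAbove t X x ≡ y
nextAbove-unique x<t y∈ x⋖y = ⋖-unique-above nextAbove-∈ y∈ (nextAbove-⋖ x<t) x⋖y

nextBelow-unique : b < y → x ∈ b ∷ Y → x ⋖⟨ b ∷ Y ⟩ y → nextBelow b Y y ≡ x
nextBelow-unique b<y x∈ x⋖y = ⋖-unique-below nextBelow-∈ x∈ (nextBelow-⋖ b<y) x⋖y

nextAbove-< : All (_< t) X → x < y → y ∈ X → nextAbove t X x < nextAbove t X y
nextAbove-< X<t x<y y∈X =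
  ≤-<-trans (≮⇒≥ (gap (nextAbove-⋖ (<-trans x<y y<t)) (there y∈X) x<y)) (lt (nextAbove-⋖ y<t))
  where y<t = All.lookup X<t y∈X

nextBelow-< : All (b <_) Y → x < y → x ∈ Y → nextBelow b Y x < nextBelow b Y y
nextBelow-< b<Y x<y x∈Y =
  <-≤-trans (lt (nextBelow-⋖ b<x)) (≮⇒≥ λ τy<x → gap (nextBelow-⋖ (<-trans b<x x<y)) (there x∈Y) τy<x x<y)
  where b<x = All.lookup b<Y x∈Y

nextAbove-monotone : All (_< t) X → StrictlyMonotoneOn X (nextAbove t X)
nextAbove-monotone X<t _ y∈X x<y = nextAbove-< X<t x<y y∈X

nextBelow-monotone : All (b <_) Y → StrictlyMonotoneOn Y (nextBelow b Y)
nextBelow-monotone b<Y x∈Y _ x<y = nextBelow-< b<Y x<y x∈Y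

max-∈ : max b Y ∈ b ∷ Y
max-∈ {b} {Y} with argmax-sel id b Y
... | inj₁ ≡b = here ≡b
... | inj₂ ∈Y = there ∈Y

≤-max : All (_≤ max b Y) (b ∷ Y)
≤-max {b} {Y} = ⊥≤max b Y ∷ xs≤max b Y

max-unique : x ∈ b ∷ Y → All (_≤ x) (b ∷ Y) → max b Y ≡ x
max-unique x∈ (b≤x ∷ Y≤x) = ≤-antisym (max≤v⁺ b≤x Y≤x) (All.lookup ≤-max x∈)

nextAbove-image : ∀ L → map (nextAbove t X) L ⊆ t ∷ X
nextAbove-image L z∈ with ∈-map⁻ _ z∈
... | _ , _ , refl = nextAbove-∈

nextBelow-image : ∀ L → map (nextBelow b Y) L ⊆ b ∷ Y
nextBelow-image L z∈ with ∈-map⁻ _ z∈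
... | _ , _ , refl = nextBelow-∈

∷-greatest : All (_< t) X → All (_≤ t) (t ∷ X)
∷-greatest X<t = ≤-refl ∷ All.map <⇒≤ X<t

∷-least : All (b <_) Y → All (b ≤_) (b ∷ Y)
∷-least b<Y = ≤-refl ∷ All.map <⇒≤ b<Y

-- Every z ∈ t ∷ X is hit by its predecessor in s ∷ X.
nextAbove-onto : s < t → All (s <_) X → All (_< t) X → t ∷ X ⊆ map (nextAbove t X) (s ∷ X)
nextAbove-onto {s} {t} {X} s<t s<X X<t {z} z∈ =
  subst (_∈ map (nextAbove t X) (s ∷ X)) σw≡z (∈-map⁺ _ (nextBelow-∈ {Y = X}))
  where
    w⋖z : nextBelow s X z ⋖⟨ s ∷ X ⟩ z
    w⋖z = nextBelow-⋖ (All.lookup (s<t ∷ s<X) z∈)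
    z≤t : z ≤ t
    z≤t = All.lookup (∷-greatest X<t) z∈
    no-gap : ∀ {u} → u ∈ t ∷ X → nextBelow s X z < u → u < z → ⊥
    no-gap (here refl) _   t<z = <⇒≱ t<z z≤t
    no-gap (there u∈X) w<u u<z = gap w⋖z (there u∈X) w<u u<z
    σw≡z : nextAbove t X (nextBelow s X z) ≡ z
    σw≡z = nextAbove-unique (<-≤-trans (lt w⋖z) z≤t) z∈ (covers (lt w⋖z) no-gap)

-- Every z ∈ b ∷ Y below the maximum is hit by its successor in Y.
nextBelow-onto : All (b <_) Y → b ∷ Y ⊆ max b Y ∷ map (nextBelow b Y) Y
nextBelow-onto {b} {Y} b<Y {z} z∈ with z ≟ max b Y
... | yes z≡M = here z≡M
... | no  z≢M = there (subst (_∈ map (nextBelow b Y) Y) τw≡z (∈-map⁺ _ w∈Y))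
  where
    M = max b Y
    z<M : z < M
    z<M = ≤∧≢⇒< (All.lookup ≤-max z∈) z≢M
    z⋖w : z ⋖⟨ M ∷ Y ⟩ nextAbove M Y z
    z⋖w = nextAbove-⋖ z<M
    M∈Y : M ∈ Y
    M∈Y with max-∈ {b} {Y}
    ... | here M≡b  = ⊥-elim (<⇒≱ z<M (subst (_≤ z) (sym M≡b) (All.lookup (∷-least b<Y) z∈)))
    ... | there M∈Y = M∈Y
    w∈Y : nextAbove M Y z ∈ Y
    w∈Y with nextAbove-∈ {M} {Y} {z}
    ... | here w≡M  = subst (_∈ Y) (sym w≡M) M∈Y
    ... | there w∈Y = w∈Y
    no-gap : ∀ {u} → u ∈ b ∷ Y → z < u → u < nextAbove M Y z → ⊥
    no-gap (here refl) z<b _   = <⇒≱ z<b (All.lookup (∷-least b<Y) z∈)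
    no-gap (there u∈Y) z<u u<w = gap z⋖w (there u∈Y) z<u u<w
    τw≡z : nextBelow b Y (nextAbove M Y z) ≡ z
    τw≡z = nextBelow-unique (≤-<-trans (All.lookup (∷-least b<Y) z∈) (lt z⋖w)) z∈ (covers (lt z⋖w) no-gap)

nextAbove-map : StrictlyMonotoneOn L g → t ∷ X ⊆ L → x ∈ L → x < t →
                nextAbove (g t) (map g X) (g x) ≡ g (nextAbove t X x)
nextAbove-map {g = g} mono tX⊆L x∈L x<t =
  nextAbove-unique (mono x∈L (tX⊆L (here refl)) x<t) (∈-map⁺ g nextAbove-∈)
    (⋖-map mono tX⊆L x∈L (tX⊆L nextAbove-∈) (nextAbove-⋖ x<t))

nextBelow-map : StrictlyMonotoneOn L g → b ∷ Y ⊆ L → y ∈ L → b < y →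
                nextBelow (g b) (map g Y) (g y) ≡ g (nextBelow b Y y)
nextBelow-map {g = g} mono bY⊆L y∈L b<y =
  nextBelow-unique (mono (bY⊆L (here refl)) y∈L b<y) (∈-map⁺ g nextBelow-∈)
    (⋖-map mono bY⊆L (bY⊆L nextBelow-∈) y∈L (nextBelow-⋖ b<y))

max-map : StrictlyMonotoneOn L g → b ∷ Y ⊆ L → max (g b) (map g Y) ≡ g (max b Y)
max-map {g = g} mono bY⊆L =
  max-unique (∈-map⁺ g max-∈)
    (All.map⁺ {xs = _ ∷ _} (All.tabulate λ z∈ →
       monotoneOn mono (bY⊆L z∈) (bY⊆L max-∈) (All.lookup ≤-max z∈)))

-- Relabelling

mutual
  relabelᴰ : (ℕ → ℕ) → Dia → Dia
  relabelᴰ g (leaf a)      = leaf (g a)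
  relabelᴰ g (node s Fs t) = node (g s) (relabelᴰs g Fs) (g t)

  relabelᴰs : (ℕ → ℕ) → List Dia → List Dia
  relabelᴰs g []       = []
  relabelᴰs g (F ∷ Fs) = relabelᴰ g F ∷ relabelᴰs g Fs

mutual
  relabelᵀ : (ℕ → ℕ) → BT → BT
  relabelᵀ g (one a)      = one (g a)
  relabelᵀ g (two a b Ts) = two (g a) (g b) (relabelᵀs g Ts)

  relabelᵀs : (ℕ → ℕ) → List BT → List BT
  relabelᵀs g []       = []
  relabelᵀs g (X ∷ Ts) = relabelᵀ g X ∷ relabelᵀs g Ts

mutual
  relabelᴰ-labels : ∀ g d → diaLabels (relabelᴰ g d) ≡ map g (diaLabels d)
  relabelᴰ-labels g (leaf a)      = refl
  relabelᴰ-labels g (node s Fs t) = cong (λ l → g s ∷ g t ∷ l) (relabelᴰs-labels g Fs)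

  relabelᴰs-labels : ∀ g Fs → diaLabelsL (relabelᴰs g Fs) ≡ map g (diaLabelsL Fs)
  relabelᴰs-labels g []       = refl
  relabelᴰs-labels g (F ∷ Fs) =
    trans (cong₂ _++_ (relabelᴰ-labels g F) (relabelᴰs-labels g Fs)) (sym (map-++ g (diaLabels F) _))

mutual
  relabelᵀ-labels : ∀ g X → btLabels (relabelᵀ g X) ≡ map g (btLabels X)
  relabelᵀ-labels g (one a)      = refl
  relabelᵀ-labels g (two a b Ts) = cong (λ l → g a ∷ g b ∷ l) (relabelᵀs-labels g Ts)

  relabelᵀs-labels : ∀ g Ts → btLabelsL (relabelᵀs g Ts) ≡ map g (btLabelsL Ts)
  relabelᵀs-labels g []       = refl
  relabelᵀs-labels g (X ∷ Ts) =
    trans (cong₂ _++_ (relabelᵀ-labels g X) (relabelᵀs-labels g Ts)) (sym (map-++ g (btLabels X) _))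

mutual
  relabelᴰ-∘ : ∀ f g d → relabelᴰ f (relabelᴰ g d) ≡ relabelᴰ (f ∘ g) d
  relabelᴰ-∘ f g (leaf a)      = refl
  relabelᴰ-∘ f g (node s Fs t) = cong (λ Gs → node (f (g s)) Gs (f (g t))) (relabelᴰs-∘ f g Fs)

  relabelᴰs-∘ : ∀ f g Fs → relabelᴰs f (relabelᴰs g Fs) ≡ relabelᴰs (f ∘ g) Fs
  relabelᴰs-∘ f g []       = refl
  relabelᴰs-∘ f g (F ∷ Fs) = cong₂ _∷_ (relabelᴰ-∘ f g F) (relabelᴰs-∘ f g Fs)

mutual
  relabelᵀ-∘ : ∀ f g X → relabelᵀ f (relabelᵀ g X) ≡ relabelᵀ (f ∘ g) X
  relabelᵀ-∘ f g (one a)      = refl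
  relabelᵀ-∘ f g (two a b Ts) = cong (two (f (g a)) (f (g b))) (relabelᵀs-∘ f g Ts)

  relabelᵀs-∘ : ∀ f g Ts → relabelᵀs f (relabelᵀs g Ts) ≡ relabelᵀs (f ∘ g) Ts
  relabelᵀs-∘ f g []       = refl
  relabelᵀs-∘ f g (X ∷ Ts) = cong₂ _∷_ (relabelᵀ-∘ f g X) (relabelᵀs-∘ f g Ts)

mutual
  relabelᴰ-cong : ∀ {f g} d → (∀ {x} → x ∈ diaLabels d → f x ≡ g x) → relabelᴰ f d ≡ relabelᴰ g d
  relabelᴰ-cong (leaf a)      f≗g = cong leaf (f≗g (here refl))
  relabelᴰ-cong {g = g} (node s Fs t) f≗g
    rewrite f≗g (here refl) | f≗g (there (here refl)) =
    cong (λ Gs → node (g s) Gs (g t)) (relabelᴰs-cong Fs (f≗g ∘ there ∘ there))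

  relabelᴰs-cong : ∀ {f g} Fs → (∀ {x} → x ∈ diaLabelsL Fs → f x ≡ g x) → relabelᴰs f Fs ≡ relabelᴰs g Fs
  relabelᴰs-cong []       f≗g = refl
  relabelᴰs-cong (F ∷ Fs) f≗g =
    cong₂ _∷_ (relabelᴰ-cong F (f≗g ∘ xs⊆xs++ys _ _)) (relabelᴰs-cong Fs (f≗g ∘ xs⊆ys++xs _ (diaLabels F)))

mutual
  relabelᵀ-cong : ∀ {f g} X → (∀ {x} → x ∈ btLabels X → f x ≡ g x) → relabelᵀ f X ≡ relabelᵀ g X
  relabelᵀ-cong (one a)      f≗g = cong one (f≗g (here refl))
  relabelᵀ-cong {g = g} (two a b Ts) f≗g
    rewrite f≗g (here refl) | f≗g (there (here refl)) =
    cong (two (g a) (g b)) (relabelᵀs-cong Ts (f≗g ∘ there ∘ there))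

  relabelᵀs-cong : ∀ {f g} Ts → (∀ {x} → x ∈ btLabelsL Ts → f x ≡ g x) → relabelᵀs f Ts ≡ relabelᵀs g Ts
  relabelᵀs-cong []       f≗g = refl
  relabelᵀs-cong (X ∷ Ts) f≗g =
    cong₂ _∷_ (relabelᵀ-cong X (f≗g ∘ xs⊆xs++ys _ _)) (relabelᵀs-cong Ts (f≗g ∘ xs⊆ys++xs _ (btLabels X)))

mutual
  relabelᴰ-id : ∀ d → relabelᴰ id d ≡ d
  relabelᴰ-id (leaf a)      = refl
  relabelᴰ-id (node s Fs t) = cong (λ Gs → node s Gs t) (relabelᴰs-id Fs)

  relabelᴰs-id : ∀ Fs → relabelᴰs id Fs ≡ Fs
  relabelᴰs-id []       = refl
  relabelᴰs-id (F ∷ Fs) = cong₂ _∷_ (relabelᴰ-id F) (relabelᴰs-id Fs)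

mutual
  relabelᵀ-id : ∀ X → relabelᵀ id X ≡ X
  relabelᵀ-id (one a)      = refl
  relabelᵀ-id (two a b Ts) = cong (two a b) (relabelᵀs-id Ts)

  relabelᵀs-id : ∀ Ts → relabelᵀs id Ts ≡ Ts
  relabelᵀs-id []       = refl
  relabelᵀs-id (X ∷ Ts) = cong₂ _∷_ (relabelᵀ-id X) (relabelᵀs-id Ts)

All-relabelᴰs⁺ : ∀ {P : ℕ → Set} g Fs → (∀ {x} → x ∈ diaLabelsL Fs → P (g x)) →
                 All P (diaLabelsL (relabelᴰs g Fs))
All-relabelᴰs⁺ g Fs P∘g = subst (All _) (sym (relabelᴰs-labels g Fs)) (All.map⁺ (All.tabulate P∘g))

All-relabelᵀs⁺ : ∀ {P : ℕ → Set} g Ts → (∀ {x} → x ∈ btLabelsL Ts → P (g x)) →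
                 All P (btLabelsL (relabelᵀs g Ts))
All-relabelᵀs⁺ g Ts P∘g = subst (All _) (sym (relabelᵀs-labels g Ts)) (All.map⁺ (All.tabulate P∘g))

mutual
  relabelᴰ-increasing : ∀ {d} → StrictlyMonotoneOn (diaLabels d) g → IncreasingDia d →
                        IncreasingDia (relabelᴰ g d)
  relabelᴰ-increasing mono leaf = leaf
  relabelᴰ-increasing {g} mono (node {Fs = Fs} s<t s<X X<t inc) =
    node (mono (here refl) (there (here refl)) s<t)
         (All-relabelᴰs⁺ g Fs λ x∈ → mono (here refl) (there (there x∈)) (All.lookup s<X x∈))
         (All-relabelᴰs⁺ g Fs λ x∈ → mono (there (there x∈)) (there (here refl)) (All.lookup X<t x∈))
         (relabelᴰs-increasing (strictlyMonotoneOn-⊆ (there ∘ there) mono) inc)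

  relabelᴰs-increasing : ∀ {Fs} → StrictlyMonotoneOn (diaLabelsL Fs) g →
                         All IncreasingDia Fs → All IncreasingDia (relabelᴰs g Fs)
  relabelᴰs-increasing mono [] = []
  relabelᴰs-increasing {Fs = F ∷ Fs} mono (inc ∷ incs) =
    relabelᴰ-increasing (strictlyMonotoneOn-⊆ (xs⊆xs++ys _ _) mono) inc ∷
    relabelᴰs-increasing (strictlyMonotoneOn-⊆ (xs⊆ys++xs _ (diaLabels F)) mono) incs

mutual
  relabelᵀ-increasing : ∀ {X} → StrictlyMonotoneOn (btLabels X) g → IncreasingBT X →
                        IncreasingBT (relabelᵀ g X)
  relabelᵀ-increasing mono one = one
  relabelᵀ-increasing {g} mono (two {Ts = Ts} a<b b<Y inc) =
    two (mono (here refl) (there (here refl)) a<b)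
        (All-relabelᵀs⁺ g Ts λ y∈ → mono (there (here refl)) (there (there y∈)) (All.lookup b<Y y∈))
        (relabelᵀs-increasing (strictlyMonotoneOn-⊆ (there ∘ there) mono) inc)

  relabelᵀs-increasing : ∀ {Ts} → StrictlyMonotoneOn (btLabelsL Ts) g →
                         All IncreasingBT Ts → All IncreasingBT (relabelᵀs g Ts)
  relabelᵀs-increasing mono [] = []
  relabelᵀs-increasing {Ts = X ∷ Ts} mono (inc ∷ incs) =
    relabelᵀ-increasing (strictlyMonotoneOn-⊆ (xs⊆xs++ys _ _) mono) inc ∷
    relabelᵀs-increasing (strictlyMonotoneOn-⊆ (xs⊆ys++xs _ (btLabels X)) mono) incs

-- The bijection

mutual
  toTree : Dia → BT
  toTree (leaf a)      = one a
  toTree (node s Fs t) = two s (σ s) (relabelᵀs σ (toTrees Fs))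
    where σ = nextAbove t (diaLabelsL Fs)

  toTrees : List Dia → List BT
  toTrees []       = []
  toTrees (F ∷ Fs) = toTree F ∷ toTrees Fs

mutual
  toDia : BT → Dia
  toDia (one a)      = leaf a
  toDia (two a b Ts) = node a (relabelᴰs τ (toDias Ts)) (max b (btLabelsL Ts))
    where τ = nextBelow b (btLabelsL Ts)

  toDias : List BT → List Dia
  toDias []       = []
  toDias (X ∷ Ts) = toDia X ∷ toDias Ts

toTree-node-labels⊆ : ∀ s Fs t → let σ = nextAbove t (diaLabelsL Fs) in
                      σ s ∷ btLabelsL (relabelᵀs σ (toTrees Fs)) ⊆ t ∷ diaLabelsL Fs
toTree-node-labels⊆ s Fs t =
  ⊆-trans (∷⁺ʳ _ (⊆-reflexive (relabelᵀs-labels _ (toTrees Fs)))) (nextAbove-image (s ∷ _))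

toTree-labels⊆ : ∀ d → btLabels (toTree d) ⊆ diaLabels d
toTree-labels⊆ (leaf a)      = id
toTree-labels⊆ (node s Fs t) = ∷⁺ʳ s (toTree-node-labels⊆ s Fs t)

toTrees-labels⊆ : ∀ Fs → btLabelsL (toTrees Fs) ⊆ diaLabelsL Fs
toTrees-labels⊆ []       = id
toTrees-labels⊆ (F ∷ Fs) = ++⁺ (toTree-labels⊆ F) (toTrees-labels⊆ Fs)

toDia-node-labels⊆ : ∀ b Ts → let τ = nextBelow b (btLabelsL Ts) in
                     max b (btLabelsL Ts) ∷ diaLabelsL (relabelᴰs τ (toDias Ts)) ⊆ b ∷ btLabelsL Ts
toDia-node-labels⊆ b Ts =
  ∈-∷⁺ʳ max-∈ (⊆-trans (⊆-reflexive (relabelᴰs-labels _ (toDias Ts))) (nextBelow-image _))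

toDia-labels⊆ : ∀ X → diaLabels (toDia X) ⊆ btLabels X
toDia-labels⊆ (one a)      = id
toDia-labels⊆ (two a b Ts) = ∷⁺ʳ a (toDia-node-labels⊆ b Ts)

toDias-labels⊆ : ∀ Ts → diaLabelsL (toDias Ts) ⊆ btLabelsL Ts
toDias-labels⊆ []       = id
toDias-labels⊆ (X ∷ Ts) = ++⁺ (toDia-labels⊆ X) (toDias-labels⊆ Ts)

mutual
  toTree-node-labels⊇ : ∀ {s Fs t} → IncreasingDia (node s Fs t) → let σ = nextAbove t (diaLabelsL Fs) in
                        t ∷ diaLabelsL Fs ⊆ σ s ∷ btLabelsL (relabelᵀs σ (toTrees Fs))
  toTree-node-labels⊇ {s} {Fs} (node s<t s<X X<t inc) =
    ⊆-trans (nextAbove-onto s<t s<X X<t)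
            (⊆-trans (map⁺ _ (∷⁺ʳ s (toTrees-labels⊇ inc)))
                     (∷⁺ʳ _ (⊆-reflexive (sym (relabelᵀs-labels _ (toTrees Fs))))))

  toTree-labels⊇ : ∀ {d} → IncreasingDia d → diaLabels d ⊆ btLabels (toTree d)
  toTree-labels⊇ leaf                     = id
  toTree-labels⊇ inc@(node {s = s} _ _ _ _) = ∷⁺ʳ s (toTree-node-labels⊇ inc)

  toTrees-labels⊇ : ∀ {Fs} → All IncreasingDia Fs → diaLabelsL Fs ⊆ btLabelsL (toTrees Fs)
  toTrees-labels⊇ []           = id
  toTrees-labels⊇ (inc ∷ incs) = ++⁺ (toTree-labels⊇ inc) (toTrees-labels⊇ incs)

mutual
  toDia-node-labels⊇ : ∀ {a b Ts} → IncreasingBT (two a b Ts) → let τ = nextBelow b (btLabelsL Ts) in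
                       b ∷ btLabelsL Ts ⊆ max b (btLabelsL Ts) ∷ diaLabelsL (relabelᴰs τ (toDias Ts))
  toDia-node-labels⊇ {Ts = Ts} (two _ b<Y inc) =
    ⊆-trans (nextBelow-onto b<Y)
            (∷⁺ʳ _ (⊆-trans (map⁺ _ (toDias-labels⊇ inc))
                            (⊆-reflexive (sym (relabelᴰs-labels _ (toDias Ts))))))

  toDia-labels⊇ : ∀ {X} → IncreasingBT X → btLabels X ⊆ diaLabels (toDia X)
  toDia-labels⊇ one                       = id
  toDia-labels⊇ inc@(two {a = a} _ _ _) = ∷⁺ʳ a (toDia-node-labels⊇ inc)

  toDias-labels⊇ : ∀ {Ts} → All IncreasingBT Ts → btLabelsL Ts ⊆ diaLabelsL (toDias Ts)
  toDias-labels⊇ []           = id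
  toDias-labels⊇ (inc ∷ incs) = ++⁺ (toDia-labels⊇ inc) (toDias-labels⊇ incs)

mutual
  toTree-size : ∀ d → length (btLabels (toTree d)) ≡ length (diaLabels d)
  toTree-size (leaf a)      = refl
  toTree-size (node s Fs t) =
    cong (suc ∘ suc) (trans (cong length (relabelᵀs-labels _ (toTrees Fs)))
                            (trans (length-map _ (btLabelsL (toTrees Fs))) (toTrees-size Fs)))

  toTrees-size : ∀ Fs → length (btLabelsL (toTrees Fs)) ≡ length (diaLabelsL Fs)
  toTrees-size []       = refl
  toTrees-size (F ∷ Fs) =
    trans (length-++ (btLabels (toTree F)))
          (trans (cong₂ _+_ (toTree-size F) (toTrees-size Fs)) (sym (length-++ (diaLabels F))))

mutual
  toDia-size : ∀ X → length (diaLabels (toDia X)) ≡ length (btLabels X)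
  toDia-size (one a)      = refl
  toDia-size (two a b Ts) =
    cong (suc ∘ suc) (trans (cong length (relabelᴰs-labels _ (toDias Ts)))
                            (trans (length-map _ (diaLabelsL (toDias Ts))) (toDias-size Ts)))

  toDias-size : ∀ Ts → length (diaLabelsL (toDias Ts)) ≡ length (btLabelsL Ts)
  toDias-size []       = refl
  toDias-size (X ∷ Ts) =
    trans (length-++ (diaLabels (toDia X)))
          (trans (cong₂ _+_ (toDia-size X) (toDias-size Ts)) (sym (length-++ (btLabels X))))

mutual
  toTree-increasing : ∀ {d} → IncreasingDia d → IncreasingBT (toTree d)
  toTree-increasing leaf = one
  toTree-increasing (node {Fs = Fs} s<t s<X X<t inc) =
    two (lt (nextAbove-⋖ s<t))
        (All-relabelᵀs⁺ _ (toTrees Fs) λ y∈ →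
          let y∈X = toTrees-labels⊆ Fs y∈ in nextAbove-< X<t (All.lookup s<X y∈X) y∈X)
        (relabelᵀs-increasing (strictlyMonotoneOn-⊆ (toTrees-labels⊆ Fs) (nextAbove-monotone X<t))
                              (toTrees-increasing inc))

  toTrees-increasing : ∀ {Fs} → All IncreasingDia Fs → All IncreasingBT (toTrees Fs)
  toTrees-increasing []           = []
  toTrees-increasing (inc ∷ incs) = toTree-increasing inc ∷ toTrees-increasing incs

mutual
  toDia-increasing : ∀ {X} → IncreasingBT X → IncreasingDia (toDia X)
  toDia-increasing one = leaf
  toDia-increasing (two {Ts = Ts} a<b b<Y inc) =
    node (<-≤-trans a<b (All.lookup (≤-max {Y = btLabelsL Ts}) (here refl)))
         (All-relabelᴰs⁺ _ (toDias Ts) λ _ → <-≤-trans a<b (All.lookup (∷-least b<Y) nextBelow-∈))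
         (All-relabelᴰs⁺ _ (toDias Ts) λ y∈ →
           let y∈Y = toDias-labels⊆ Ts y∈ in
           <-≤-trans (lt (nextBelow-⋖ (All.lookup b<Y y∈Y))) (All.lookup ≤-max (there y∈Y)))
         (relabelᴰs-increasing (strictlyMonotoneOn-⊆ (toDias-labels⊆ Ts) (nextBelow-monotone b<Y))
                               (toDias-increasing inc))

  toDias-increasing : ∀ {Ts} → All IncreasingBT Ts → All IncreasingDia (toDias Ts)
  toDias-increasing []           = []
  toDias-increasing (inc ∷ incs) = toDia-increasing inc ∷ toDias-increasing incs

mutual
  toTree-relabel : ∀ {d} → StrictlyMonotoneOn (diaLabels d) g → IncreasingDia d →
                   toTree (relabelᴰ g d) ≡ relabelᵀ g (toTree d)
  toTree-relabel mono leaf = refl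
  toTree-relabel {g} mono (node {s = s} {t = t} {Fs = Fs} s<t s<X X<t inc) =
    cong₂ (two (g s)) (σ′∘g≡g∘σ (here refl) s<t) (begin
      relabelᵀs σ′ (toTrees (relabelᴰs g Fs))
        ≡⟨ cong (relabelᵀs σ′) (toTrees-relabel (strictlyMonotoneOn-⊆ (there ∘ there) mono) inc) ⟩
      relabelᵀs σ′ (relabelᵀs g (toTrees Fs))
        ≡⟨ relabelᵀs-∘ σ′ g (toTrees Fs) ⟩
      relabelᵀs (σ′ ∘ g) (toTrees Fs)
        ≡⟨ relabelᵀs-cong (toTrees Fs) (λ y∈ → let y∈X = toTrees-labels⊆ Fs y∈ in
                                         σ′∘g≡g∘σ (there (there y∈X)) (All.lookup X<t y∈X)) ⟩
      relabelᵀs (g ∘ σ) (toTrees Fs)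
        ≡⟨ relabelᵀs-∘ g σ (toTrees Fs) ⟨
      relabelᵀs g (relabelᵀs σ (toTrees Fs)) ∎)
    where
      open ≡-Reasoning
      σ  = nextAbove t (diaLabelsL Fs)
      σ′ = nextAbove (g t) (diaLabelsL (relabelᴰs g Fs))
      σ′∘g≡g∘σ : ∀ {x} → x ∈ diaLabels (node s Fs t) → x < t → σ′ (g x) ≡ g (σ x)
      σ′∘g≡g∘σ {x} x∈ x<t =
        trans (cong (λ X → nextAbove (g t) X (g x)) (relabelᴰs-labels g Fs))
              (nextAbove-map mono there x∈ x<t)

  toTrees-relabel : ∀ {Fs} → StrictlyMonotoneOn (diaLabelsL Fs) g → All IncreasingDia Fs →
                    toTrees (relabelᴰs g Fs) ≡ relabelᵀs g (toTrees Fs)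
  toTrees-relabel mono [] = refl
  toTrees-relabel {Fs = F ∷ Fs} mono (inc ∷ incs) =
    cong₂ _∷_ (toTree-relabel (strictlyMonotoneOn-⊆ (xs⊆xs++ys _ _) mono) inc)
              (toTrees-relabel (strictlyMonotoneOn-⊆ (xs⊆ys++xs _ (diaLabels F)) mono) incs)

mutual
  toDia-relabel : ∀ {X} → StrictlyMonotoneOn (btLabels X) g → IncreasingBT X →
                  toDia (relabelᵀ g X) ≡ relabelᴰ g (toDia X)
  toDia-relabel mono one = refl
  toDia-relabel {g} mono (two {a = a} {b = b} {Ts = Ts} a<b b<Y inc) =
    cong₂ (node (g a)) (begin
      relabelᴰs τ′ (toDias (relabelᵀs g Ts))
        ≡⟨ cong (relabelᴰs τ′) (toDias-relabel (strictlyMonotoneOn-⊆ (there ∘ there) mono) inc) ⟩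
      relabelᴰs τ′ (relabelᴰs g (toDias Ts))
        ≡⟨ relabelᴰs-∘ τ′ g (toDias Ts) ⟩
      relabelᴰs (τ′ ∘ g) (toDias Ts)
        ≡⟨ relabelᴰs-cong (toDias Ts) (λ y∈ → let y∈Y = toDias-labels⊆ Ts y∈ in
                                        τ′∘g≡g∘τ (there (there y∈Y)) (All.lookup b<Y y∈Y)) ⟩
      relabelᴰs (g ∘ τ) (toDias Ts)
        ≡⟨ relabelᴰs-∘ g τ (toDias Ts) ⟨
      relabelᴰs g (relabelᴰs τ (toDias Ts)) ∎)
      (trans (cong (max (g b)) (relabelᵀs-labels g Ts)) (max-map mono there))
    where
      open ≡-Reasoning
      τ  = nextBelow b (btLabelsL Ts)
      τ′ = nextBelow (g b) (btLabelsL (relabelᵀs g Ts))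
      τ′∘g≡g∘τ : ∀ {y} → y ∈ btLabels (two a b Ts) → b < y → τ′ (g y) ≡ g (τ y)
      τ′∘g≡g∘τ {y} y∈ b<y =
        trans (cong (λ Y → nextBelow (g b) Y (g y)) (relabelᵀs-labels g Ts))
              (nextBelow-map mono there y∈ b<y)

  toDias-relabel : ∀ {Ts} → StrictlyMonotoneOn (btLabelsL Ts) g → All IncreasingBT Ts →
                   toDias (relabelᵀs g Ts) ≡ relabelᴰs g (toDias Ts)
  toDias-relabel mono [] = refl
  toDias-relabel {Ts = X ∷ Ts} mono (inc ∷ incs) =
    cong₂ _∷_ (toDia-relabel (strictlyMonotoneOn-⊆ (xs⊆xs++ys _ _) mono) inc)
              (toDias-relabel (strictlyMonotoneOn-⊆ (xs⊆ys++xs _ (btLabels X)) mono) incs)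

mutual
  toDia-toTree : ∀ {d} → IncreasingDia d → toDia (toTree d) ≡ d
  toDia-toTree leaf = refl
  toDia-toTree inc@(node {s = s} {t = t} {Fs = Fs} s<t s<X X<t incs) =
    cong₂ (node s) (begin
      relabelᴰs τ (toDias (relabelᵀs σ (toTrees Fs)))
        ≡⟨ cong (relabelᴰs τ) (toDias-relabel σ-mono (toTrees-increasing incs)) ⟩
      relabelᴰs τ (relabelᴰs σ (toDias (toTrees Fs)))
        ≡⟨ cong (relabelᴰs τ ∘ relabelᴰs σ) (toDias-toTrees incs) ⟩
      relabelᴰs τ (relabelᴰs σ Fs)                   ≡⟨ relabelᴰs-∘ τ σ Fs ⟩
      relabelᴰs (τ ∘ σ) Fs                           ≡⟨ relabelᴰs-cong Fs τ∘σ≡id ⟩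
      relabelᴰs id Fs                                ≡⟨ relabelᴰs-id Fs ⟩
      Fs                                             ∎)
      (max-unique (U′⊇ (here refl)) (All.tabulate (All.lookup (∷-greatest X<t) ∘ U′⊆)))
    where
      open ≡-Reasoning
      σ  = nextAbove t (diaLabelsL Fs)
      Y′ = btLabelsL (relabelᵀs σ (toTrees Fs))
      τ  = nextBelow (σ s) Y′
      U′⊆ : σ s ∷ Y′ ⊆ t ∷ diaLabelsL Fs
      U′⊆ = toTree-node-labels⊆ s Fs t
      U′⊇ : t ∷ diaLabelsL Fs ⊆ σ s ∷ Y′
      U′⊇ = toTree-node-labels⊇ inc
      σ-mono : StrictlyMonotoneOn (btLabelsL (toTrees Fs)) σ
      σ-mono = strictlyMonotoneOn-⊆ (toTrees-labels⊆ Fs) (nextAbove-monotone X<t)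
      -- σ s ∷ Y′ and t ∷ X are the same set, in which σ x covers x; so τ undoes σ.
      τ∘σ≡id : ∀ {x} → x ∈ diaLabelsL Fs → τ (σ x) ≡ x
      τ∘σ≡id x∈X =
        nextBelow-unique (nextAbove-< X<t (All.lookup s<X x∈X) x∈X) (U′⊇ (there x∈X))
          (⋖-anti-mono U′⊆ (nextAbove-⋖ (All.lookup X<t x∈X)))

  toDias-toTrees : ∀ {Fs} → All IncreasingDia Fs → toDias (toTrees Fs) ≡ Fs
  toDias-toTrees []           = refl
  toDias-toTrees (inc ∷ incs) = cong₂ _∷_ (toDia-toTree inc) (toDias-toTrees incs)

mutual
  toTree-toDia : ∀ {X} → IncreasingBT X → toTree (toDia X) ≡ X
  toTree-toDia one = refl
  toTree-toDia inc@(two {a = a} {b = b} {Ts = Ts} a<b b<Y incs) =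
    cong₂ (two a) σa≡b (begin
      relabelᵀs σ (toTrees (relabelᴰs τ (toDias Ts)))
        ≡⟨ cong (relabelᵀs σ) (toTrees-relabel τ-mono (toDias-increasing incs)) ⟩
      relabelᵀs σ (relabelᵀs τ (toTrees (toDias Ts)))
        ≡⟨ cong (relabelᵀs σ ∘ relabelᵀs τ) (toTrees-toDias incs) ⟩
      relabelᵀs σ (relabelᵀs τ Ts)                   ≡⟨ relabelᵀs-∘ σ τ Ts ⟩
      relabelᵀs (σ ∘ τ) Ts                           ≡⟨ relabelᵀs-cong Ts σ∘τ≡id ⟩
      relabelᵀs id Ts                                ≡⟨ relabelᵀs-id Ts ⟩
      Ts                                             ∎)
    where
      open ≡-Reasoning
      M  = max b (btLabelsL Ts)
      ≤M : All (_≤ M) (b ∷ btLabelsL Ts)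
      ≤M = ≤-max
      τ  = nextBelow b (btLabelsL Ts)
      X′ = diaLabelsL (relabelᴰs τ (toDias Ts))
      σ  = nextAbove M X′
      U′⊆ : M ∷ X′ ⊆ b ∷ btLabelsL Ts
      U′⊆ = toDia-node-labels⊆ b Ts
      U′⊇ : b ∷ btLabelsL Ts ⊆ M ∷ X′
      U′⊇ = toDia-node-labels⊇ inc
      τ-mono : StrictlyMonotoneOn (diaLabelsL (toDias Ts)) τ
      τ-mono = strictlyMonotoneOn-⊆ (toDias-labels⊆ Ts) (nextBelow-monotone b<Y)
      σa≡b : σ a ≡ b
      σa≡b = nextAbove-unique (<-≤-trans a<b (All.lookup ≤M (here refl))) (U′⊇ (here refl))
               (covers a<b λ z∈ _ z<b → <⇒≱ z<b (All.lookup (∷-least b<Y) (U′⊆ z∈)))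
      σ∘τ≡id : ∀ {y} → y ∈ btLabelsL Ts → σ (τ y) ≡ y
      σ∘τ≡id y∈Y =
        nextAbove-unique (<-≤-trans (lt τy⋖y) (All.lookup ≤M (there y∈Y))) (U′⊇ (there y∈Y))
                         (⋖-anti-mono U′⊆ τy⋖y)
        where τy⋖y = nextBelow-⋖ (All.lookup b<Y y∈Y)

  toTrees-toDias : ∀ {Ts} → All IncreasingBT Ts → toTrees (toDias Ts) ≡ Ts
  toTrees-toDias []           = refl
  toTrees-toDias (inc ∷ incs) = cong₂ _∷_ (toTree-toDia inc) (toTrees-toDias incs)

length-relabelᵀs : ∀ g Ts → length (relabelᵀs g Ts) ≡ length Ts
length-relabelᵀs g []       = refl
length-relabelᵀs g (X ∷ Ts) = cong suc (length-relabelᵀs g Ts)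

mutual
  capOne-relabelᵀ : ∀ g X → capOne (relabelᵀ g X) ≡ capOne X
  capOne-relabelᵀ g (one a)      = refl
  capOne-relabelᵀ g (two a b Ts) = capOneL-relabelᵀs g Ts

  capOneL-relabelᵀs : ∀ g Ts → capOneL (relabelᵀs g Ts) ≡ capOneL Ts
  capOneL-relabelᵀs g []       = refl
  capOneL-relabelᵀs g (X ∷ Ts) = cong₂ _+_ (capOne-relabelᵀ g X) (capOneL-relabelᵀs g Ts)

mutual
  innerNodes-toTree : ∀ d → innerNodes d ≡ capOne (toTree d)
  innerNodes-toTree (leaf a)      = refl
  innerNodes-toTree (node s Fs t) = trans (innerNodesL-toTrees Fs) (sym (capOneL-relabelᵀs _ (toTrees Fs)))

  innerNodesL-toTrees : ∀ Fs → innerNodesL Fs ≡ capOneL (toTrees Fs)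
  innerNodesL-toTrees []       = refl
  innerNodesL-toTrees (F ∷ Fs) = cong₂ _+_ (innerNodes-toTree F) (innerNodesL-toTrees Fs)

length-toTrees : ∀ Fs → length (toTrees Fs) ≡ length Fs
length-toTrees []       = refl
length-toTrees (F ∷ Fs) = cong suc (length-toTrees Fs)

module _ {c ℓ} (R : CommutativeSemiring c ℓ) (φ : ℕ → CommutativeSemiring.Carrier R) where
  open CommutativeSemiring R using (_*_)
  open Weights R φ

  mutual
    btWeight-relabelᵀ : ∀ g X → btWeight (relabelᵀ g X) ≡ btWeight X
    btWeight-relabelᵀ g (one a)      = refl
    btWeight-relabelᵀ g (two a b Ts) =
      cong₂ _*_ (cong φ (length-relabelᵀs g Ts)) (btWeightL-relabelᵀs g Ts)

    btWeightL-relabelᵀs : ∀ g Ts → btWeightL (relabelᵀs g Ts) ≡ btWeightL Ts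
    btWeightL-relabelᵀs g []       = refl
    btWeightL-relabelᵀs g (X ∷ Ts) = cong₂ _*_ (btWeight-relabelᵀ g X) (btWeightL-relabelᵀs g Ts)

  mutual
    diaWeight-toTree : ∀ d → diaWeight d ≡ btWeight (toTree d)
    diaWeight-toTree (leaf a)      = refl
    diaWeight-toTree (node s Fs t) =
      cong₂ _*_ (cong φ (sym (trans (length-relabelᵀs _ (toTrees Fs)) (length-toTrees Fs))))
                (trans (diaWeightL-toTrees Fs) (sym (btWeightL-relabelᵀs _ (toTrees Fs))))

    diaWeightL-toTrees : ∀ Fs → diaWeightL Fs ≡ btWeightL (toTrees Fs)
    diaWeightL-toTrees []       = refl
    diaWeightL-toTrees (F ∷ Fs) = cong₂ _*_ (diaWeight-toTree F) (diaWeightL-toTrees Fs)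

diamond-valid : ∀ {n} (D : Diamond n) → IncreasingDia (proj₁ D) × T (isLabelling (diaLabels (proj₁ D)) n)
diamond-valid (d , valid) =
  let increasing , labelling = Equivalence.to (T-∧ {diaOK d}) valid in
  Equivalence.to (increasingDia d) increasing , labelling

bucketTree-valid : ∀ {n} (X : BucketTree n) → IncreasingBT (proj₁ X) × T (isLabelling (btLabels (proj₁ X)) n)
bucketTree-valid (x , valid) =
  let increasing , labelling = Equivalence.to (T-∧ {btOK x}) valid in
  Equivalence.to (increasingBT x) increasing , labelling

toBucketTree : ∀ {n} → Diamond n → BucketTree n
toBucketTree D@(d , _) =
  let inc , labelling = diamond-valid D in
  toTree d , Equivalence.from T-∧ ( Equivalence.from (increasingBT (toTree d)) (toTree-increasing inc)
                                  , isLabelling-⊆ (sym (toTree-size d)) (toTree-labels⊇ inc) labelling)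

toDiamond : ∀ {n} → BucketTree n → Diamond n
toDiamond X@(x , _) =
  let inc , labelling = bucketTree-valid X in
  toDia x , Equivalence.from T-∧ ( Equivalence.from (increasingDia (toDia x)) (toDia-increasing inc)
                                 , isLabelling-⊆ (sym (toDia-size x)) (toDia-labels⊇ inc) labelling)

mainTheorem3 : ∀ {c ℓ} (R : CommutativeSemiring c ℓ)
               (φ : ℕ → CommutativeSemiring.Carrier R) (n : ℕ) → 1 ≤ n →
               Σ (Diamond n ⤖ BucketTree n) (λ f → (D : Diamond n) →
                 (innerNodes (proj₁ D) ≡ capOne (proj₁ (Bijection.to f D)))
                 × CommutativeSemiring._≈_ R (Weights.diaWeight R φ (proj₁ D))
                     (Weights.btWeight R φ (proj₁ (Bijection.to f D))))
mainTheorem3 R φ n _ =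
  ↔⇒⤖ (mk↔ₛ′ toBucketTree toDiamond
        (λ X → ≡-on-shapes (toTree-toDia (proj₁ (bucketTree-valid X))))
        (λ D → ≡-on-shapes (toDia-toTree (proj₁ (diamond-valid D)))))
  , λ (d , _) → innerNodes-toTree d , CommutativeSemiring.reflexive R (diaWeight-toTree R φ d)
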